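{- Let $H$ be a comparability graph, let $B$ be the canonical modular decomposition of $H$, and let $(T,D)$ be a restricted modular decomposition of $H$. Let $\mu$ be a prime node of $B$ and let $\mu'=\mathrm{lca}_T(L_B(\mu))$. Then $\mu'$ is (labeled) prime in $T$, every $\mu$-set (with respect to $B$) is a $\mu'$-set (with respect to $T$), and for every edge $uv$ of $H$ with $\mathrm{lca}_B(u,v)=\mu$ we have $\mathrm{lca}_T(u,v)=\mu'$.
   Context: For a rooted tree $T$ and node $\mu$, $L_T(\mu)$ is the leaf set of the subtree rooted at $\mu$, and $\mathrm{lca}_T$ denotes lowest common ancestor (of vertices or of a set of leaves). A module of $H=(V,E)$ is a nonempty $M\subseteq V$ such that each vertex outside $M$ is adjacent to all or none of $M$; a graph with $\ge3$ vertices is prime if its only modules are $V$ and singletons. A modular decomposition of $H$ is a rooted tree with leaf set $V$ such that every $L(\mu)$ is a module; the quotient graph $H[\mu]$ of an inner node $\mu$ is obtained from $H[L(\mu)]$ by contracting $L(\nu)$ into one vertex for each child $\nu$. The canonical modular decomposition is the unique modular decomposition whose quotient graphs are all edgeless (empty), complete or prime, with no two adjacent nodes both complete or both empty. A restricted modular decomposition $(T,D)$ of a comparability graph $H$ is a modular decomposition $T$ of $H$ in which each inner node is labeled complete, empty or prime, such that every node labeled complete (resp. empty) has a complete (resp. edgeless) quotient graph, together with a function $D$ assigning to each node $\mu$ labeled prime a transitive orientation $D_\mu$ of $H[\mu]$ (a node labeled prime need not have a prime quotient graph). For a node $\mu$ of a modular decomposition, a $\mu$-set is a subset of $L(\mu)$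 containing at most one leaf of $L(\lambda)$ for each child $\lambda$ of $\mu$. -}

module Defs where

open import Level using (0ℓ)
open import Data.Nat using (ℕ; zero; suc; _≤_)
open import Data.Fin using (Fin)
open import Data.Fin.Subset using (Subset; _∈_)
open import Data.Product using (Σ; ∃; ∃-syntax; _×_; _,_)
open import Data.Sum using (_⊎_)
open import Relation.Nullary using (¬_)
open import Relation.Binary using (Rel)
open import Relation.Binary.PropositionalEquality using (_≡_; _≢_)

IsModule : ∀ {k} → Rel (Fin k) 0ℓ → (Fin k → Set) → Set
IsModule {k} E M =
  (∃[ x ] M x) ×
  (∀ (x : Fin k) → ¬ M x → (∀ y → M y → E x y) ⊎ (∀ y → M y → ¬ E x y))

Complete : ∀ {k} → Rel (Fin k) 0ℓ → Set
Complete E = ∀ i j → i ≢ j → E i j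

Edgeless : ∀ {k} → Rel (Fin k) 0ℓ → Set
Edgeless E = ∀ i j → ¬ E i j

PrimeGraph : ∀ {k} → Rel (Fin k) 0ℓ → Set₁
PrimeGraph {k} E =
  (3 ≤ k) ×
  (∀ (M : Fin k → Set) → IsModule E M →
     (∀ x → M x) ⊎ (∃[ x ] (∀ y → M y → y ≡ x)))

IsTransitiveOrientation : ∀ {k} → Rel (Fin k) 0ℓ → Rel (Fin k) 0ℓ → Set
IsTransitiveOrientation E O =
  (∀ {i j} → O i j → E i j) ×
  (∀ {i j} → E i j → O i j ⊎ O j i) ×
  (∀ {i j} → O i j → ¬ O j i) ×
  (∀ {i j l} → O i j → O j l → O i l)

record Graph (n : ℕ) : Set₁ where
  field
    E     : Rel (Fin n) 0ℓ
    sym   : ∀ {x y} → E x y → E y x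
    irrefl : ∀ {x} → ¬ E x x

IsComparabilityGraph : ∀ {n} → Graph n → Set₁
IsComparabilityGraph H = ∃[ O ] IsTransitiveOrientation (Graph.E H) O

data Tree (Lb : Set) (n : ℕ) : Set where
  leaf : Fin n → Tree Lb n
  node : (k : ℕ) → Lb → (Fin k → Tree Lb n) → Tree Lb n

module _ {Lb : Set} {n : ℕ} where

  IsNode : Tree Lb n → Set
  IsNode (leaf _) = Data.Empty.⊥ where import Data.Empty
  IsNode (node _ _ _) = Data.Unit.⊤ where import Data.Unit

  arity : Tree Lb n → ℕ
  arity (leaf _) = 0
  arity (node k _ _) = k

  child : (t : Tree Lb n) → Fin (arity t) → Tree Lb n
  child (node _ _ f) i = f i

  data HasLabel : Tree Lb n → Lb → Set where
    labelled : ∀ {k l f} → HasLabel (node k l f) l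

  Lf : Tree Lb n → Fin n → Set
  Lf (leaf v) x = v ≡ x
  Lf (node k _ f) x = Σ (Fin k) λ i → Lf (f i) x

  -- positions (= nodes) of a tree
  data Pos : Tree Lb n → Set where
    here  : ∀ {t} → Pos t
    there : ∀ {k l f} (i : Fin k) → Pos (f i) → Pos (node k l f)

  subtree : {t : Tree Lb n} → Pos t → Tree Lb n
  subtree {t} here = t
  subtree (there i p) = subtree p

  -- p ≼ q : p is an ancestor of q (or p = q)
  data _≼_ : {t : Tree Lb n} → Pos t → Pos t → Set where
    here≼  : ∀ {t} {q : Pos t} → here ≼ q
    there≼ : ∀ {k l f i} {p q : Pos (f i)} → p ≼ q →
             there {k = k} {l} {f} i p ≼ there i q

  L : {t : Tree Lb n} → Pos t → Fin n → Set
  L p = Lf (subtree p)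

  IsTreeOn : Tree Lb n → Set
  IsTreeOn t =
    (∀ (p : Pos t) → IsNode (subtree p) → 1 ≤ arity (subtree p)) ×
    (∀ v → ∃[ p ] (subtree {t} p ≡ leaf v)) ×
    (∀ v (p q : Pos t) → subtree p ≡ leaf v → subtree q ≡ leaf v → p ≡ q)

  IsLCA : {t : Tree Lb n} → Pos t → (Fin n → Set) → Set
  IsLCA {t} μ S =
    (∀ x → S x → L μ x) ×
    (∀ (q : Pos t) → (∀ x → S x → L q x) → q ≼ μ)

  IsMuSet : {t : Tree Lb n} → Pos t → Subset n → Set
  IsMuSet μ S =
    (∀ x → x ∈ S → L μ x) ×
    (∀ (i : Fin (arity (subtree μ))) x y → x ∈ S → y ∈ S →
       Lf (child (subtree μ) i) x → Lf (child (subtree μ) i) y → x ≡ y)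

  Quotient : Graph n → (t : Tree Lb n) → Rel (Fin (arity t)) 0ℓ
  Quotient H t i j =
    i ≢ j × ∃[ x ] ∃[ y ] (Lf (child t i) x × Lf (child t j) y × Graph.E H x y)

  IsModularDecomposition : Graph n → Tree Lb n → Set
  IsModularDecomposition H t =
    IsTreeOn t × (∀ (p : Pos t) → IsModule (Graph.E H) (L p))

open import Data.Unit using (⊤)

IsCanonicalMD : ∀ {n} → Graph n → Tree ⊤ n → Set₁
IsCanonicalMD H B =
  IsModularDecomposition H B ×
  (∀ (p : Pos B) → IsNode (subtree p) → 2 ≤ arity (subtree p)) ×
  (∀ (p : Pos B) → IsNode (subtree p) →
     Edgeless (Quotient H (subtree p)) ⊎ Complete (Quotient H (subtree p))
       ⊎ PrimeGraph (Quotient H (subtree p))) ×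
  (∀ (p : Pos B) (i : Fin (arity (subtree p))) →
     IsNode (subtree p) → IsNode (child (subtree p) i) →
     ¬ (Complete (Quotient H (subtree p)) × Complete (Quotient H (child (subtree p) i)))
     × ¬ (Edgeless (Quotient H (subtree p)) × Edgeless (Quotient H (child (subtree p) i))))

IsPrimeNode : ∀ {n} → Graph n → {B : Tree ⊤ n} → Pos B → Set₁
IsPrimeNode H μ = IsNode (subtree μ) × PrimeGraph (Quotient H (subtree μ))

data Label : Set where
  complete empty prime : Label

IsRestrictedMD : ∀ {n} → (H : Graph n) → (T : Tree Label n) →
  ((p : Pos T) → HasLabel (subtree p) prime → Rel (Fin (arity (subtree p))) 0ℓ) → Set
IsRestrictedMD H T D =
  IsModularDecomposition H T ×
  (∀ (p : Pos T) → HasLabel (subtree p) complete → Complete (Quotient H (subtree p))) ×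
  (∀ (p : Pos T) → HasLabel (subtree p) empty → Edgeless (Quotient H (subtree p))) ×
  (∀ (p : Pos T) (h : HasLabel (subtree p) prime) →
     IsTransitiveOrientation (Quotient H (subtree p)) (D p h))

Pair : ∀ {n} → Fin n → Fin n → Fin n → Set
Pair u v x = x ≡ u ⊎ x ≡ v

-- The children of the prime node μ of B form a partition of L_B(μ) into
-- modules whose quotient is prime. A module meeting two of these parts
-- contains all of them: the parts it meets form a module of the prime
-- quotient, hence all of it, and a vertex of L_B(μ) outside the module
-- would be universal or isolated in the quotient. Applied to the nodes of
-- T this gives all three claims. No child of μ' contains L_B(μ), so each
-- child of μ' meets at most one child of μ; this is the μ-set claim, and
-- it means that edges between children of μ are edges between distinct
-- children of μ', so if the quotient of μ' were complete or edgeless,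
-- so would be the (prime) quotient of μ. Finally,
-- every node of T containing an edge uv with lca_B(u,v) = μ contains
-- L_B(μ), hence lies above μ'.
module Submission where

open import Defs
open import Level using (0ℓ)
open import Data.Nat using (ℕ; zero; suc; _≤_; s≤s)
open import Data.Fin using (Fin; zero; suc; _≟_)
open import Data.Fin.Properties using (any?)
open import Data.Fin.Subset using (Subset)
open import Data.Unit using (⊤; tt)
open import Data.Empty using (⊥-elim)
open import Data.Product using (_×_; Σ; ∃; ∃-syntax; _,_; proj₁; proj₂)
open import Data.Sum using (_⊎_; inj₁; inj₂; [_,_]′)
open import Function using (_∘′_)
open import Relation.Nullary using (¬_; Dec)
open import Relation.Nullary.Decidable using (decidable-stable)
open import Relation.Binary using (Rel)
open import Relation.Binary.PropositionalEquality
  using (_≡_; _≢_; refl; sym; trans; subst; ≢-sym)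

PairwiseDisjoint : ∀ {n k} → (Fin k → Fin n → Set) → Set
PairwiseDisjoint {k = k} X = ∀ (d e : Fin k) x → X d x → X e x → d ≡ e

distinct-pair : ∀ {k} → 3 ≤ k → Σ (Fin k) λ a → Σ (Fin k) λ b → a ≢ b
distinct-pair (s≤s (s≤s (s≤s _))) = zero , suc zero , λ ()

two-others : ∀ {k} → 3 ≤ k → (c : Fin k) →
  Σ (Fin k) λ a → Σ (Fin k) λ b → a ≢ c × b ≢ c × a ≢ b
two-others (s≤s (s≤s (s≤s _))) zero = suc zero , suc (suc zero) , (λ ()) , (λ ()) , (λ ())
two-others (s≤s (s≤s (s≤s _))) (suc zero) = zero , suc (suc zero) , (λ ()) , (λ ()) , (λ ())
two-others (s≤s (s≤s (s≤s _))) (suc (suc _)) = zero , suc zero , (λ ()) , (λ ()) , (λ ())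

Lf? : ∀ {Lb n} (t : Tree Lb n) x → Dec (Lf t x)
Lf? (leaf v) x = v ≟ x
Lf? (node k l f) x = any? (λ i → Lf? (f i) x)

module _ {Lb : Set} {n : ℕ} where

  children : (s : Tree Lb n) → Fin (arity s) → Fin n → Set
  children s a = Lf (child s a)

  Lf-child : (s : Tree Lb n) → IsNode s → ∀ {x} → Lf s x → ∃ λ a → children s a x
  Lf-child (node k l f) _ x∈s = x∈s

  child-Lf : (s : Tree Lb n) → ∀ {a x} → children s a x → Lf s x
  child-Lf (node k l f) {a} x∈a = a , x∈a

  _++ᴾ_ : {t : Tree Lb n} (p : Pos t) → Pos (subtree p) → Pos t
  here ++ᴾ q = q
  there i p ++ᴾ q = there i (p ++ᴾ q)

  subtree-++ᴾ : {t : Tree Lb n} (p : Pos t) (q : Pos (subtree p)) →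
    subtree (p ++ᴾ q) ≡ subtree q
  subtree-++ᴾ here q = refl
  subtree-++ᴾ (there i p) q = subtree-++ᴾ p q

  there-injective : ∀ {k l} {f : Fin k → Tree Lb n} {i} {p q : Pos (f i)} →
    there {k = k} {l} {f} i p ≡ there i q → p ≡ q
  there-injective refl = refl

  ++ᴾ-injectiveʳ : {t : Tree Lb n} (p : Pos t) {q q′ : Pos (subtree p)} →
    p ++ᴾ q ≡ p ++ᴾ q′ → q ≡ q′
  ++ᴾ-injectiveʳ here eq = eq
  ++ᴾ-injectiveʳ (there i p) eq = ++ᴾ-injectiveʳ p (there-injective eq)

  childPos : {t : Tree Lb n} (p : Pos t) → Fin (arity (subtree p)) → Pos t
  childPos {node k l f} here a = there a here
  childPos (there i p) a = there i (childPos p a)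

  subtree-childPos : {t : Tree Lb n} (p : Pos t) (a : Fin (arity (subtree p))) →
    subtree (childPos p a) ≡ child (subtree p) a
  subtree-childPos {node k l f} here a = refl
  subtree-childPos (there i p) a = subtree-childPos p a

  childPos-⋠ : {t : Tree Lb n} (p : Pos t) (a : Fin (arity (subtree p))) →
    ¬ (childPos p a ≼ p)
  childPos-⋠ {node k l f} here a ()
  childPos-⋠ (there i p) a (there≼ below) = childPos-⋠ p a below

  leafPos : (s : Tree Lb n) → ∀ {x} → Lf s x → Σ (Pos s) λ q → subtree q ≡ leaf x
  leafPos (leaf v) refl = here , refl
  leafPos (node k l f) (a , x∈a) with leafPos (f a) x∈a
  ... | q , q-leaf = there a q , q-leaf

  LeavesUnique : Tree Lb n → Set
  LeavesUnique s = ∀ v (p q : Pos s) → subtree p ≡ leaf v → subtree q ≡ leaf v → p ≡ q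

  LeavesUnique-subtree : {t : Tree Lb n} → LeavesUnique t → (p : Pos t) →
    LeavesUnique (subtree p)
  LeavesUnique-subtree unique p v q q′ q-leaf q′-leaf = ++ᴾ-injectiveʳ p
    (unique v (p ++ᴾ q) (p ++ᴾ q′)
      (trans (subtree-++ᴾ p q) q-leaf) (trans (subtree-++ᴾ p q′) q′-leaf))

  children-disjoint : (s : Tree Lb n) → LeavesUnique s → PairwiseDisjoint (children s)
  children-disjoint (node k l f) unique a b x x∈a x∈b
    with leafPos (f a) x∈a | leafPos (f b) x∈b
  ... | q , q-leaf | q′ , q′-leaf with unique x (there a q) (there b q′) q-leaf q′-leaf
  ... | refl = refl

  InnerNodesNonempty : Tree Lb n → Set
  InnerNodesNonempty s = ∀ (p : Pos s) → IsNode (subtree p) → 1 ≤ arity (subtree p)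

  InnerNodesNonempty-subtree : {t : Tree Lb n} → InnerNodesNonempty t → (p : Pos t) →
    InnerNodesNonempty (subtree p)
  InnerNodesNonempty-subtree nonempty p q =
    subst (λ s → IsNode s → 1 ≤ arity s) (subtree-++ᴾ p q) (nonempty (p ++ᴾ q))

  Lf-nonempty : (s : Tree Lb n) → InnerNodesNonempty s → ∃ (Lf s)
  Lf-nonempty (leaf v) _ = v , refl
  Lf-nonempty (node zero l f) nonempty with nonempty here tt
  ... | ()
  Lf-nonempty (node (suc k) l f) nonempty
    with Lf-nonempty (f zero) (λ q → nonempty (there zero q))
  ... | x , x∈f0 = x , zero , x∈f0

  children-nonempty : {t : Tree Lb n} → InnerNodesNonempty t → (p : Pos t) →
    ∀ a → ∃ (children (subtree p) a)
  children-nonempty nonempty p a =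
    subst (λ s → ∃ (Lf s)) (subtree-childPos p a)
      (Lf-nonempty _ (InnerNodesNonempty-subtree nonempty (childPos p a)))

  children-modules : ∀ {H t} → IsModularDecomposition H t → (p : Pos t) →
    ∀ a → IsModule (Graph.E H) (children (subtree p) a)
  children-modules {H} (_ , modules) p a =
    subst (λ s → IsModule (Graph.E H) (Lf s)) (subtree-childPos p a) (modules (childPos p a))

  lca-child-misses : ∀ {t : Tree Lb n} {μ : Pos t} {S} → IsLCA μ S →
    ∀ a → ¬ (∀ x → S x → children (subtree μ) a x)
  lca-child-misses {μ = μ} (_ , least) a S⊆a = childPos-⋠ μ a (least (childPos μ a)
    λ x Sx → subst (λ s → Lf s x) (sym (subtree-childPos μ a)) (S⊆a x Sx))

  lca-pair-children-distinct : ∀ {t : Tree Lb n} {μ : Pos t} {u v i j} → IsLCA μ (Pair u v) →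
    children (subtree μ) i u → children (subtree μ) j v → i ≢ j
  lca-pair-children-distinct {i = i} uv-lca u∈i v∈j refl =
    lca-child-misses uv-lca i λ { _ (inj₁ refl) → u∈i ; _ (inj₂ refl) → v∈j }

module _ {k} {Q : Rel (Fin k) 0ℓ} (Q-prime : PrimeGraph Q) where

  private
    -- otherwise the vertices other than c form a nontrivial module
    no-uniform-vertex : ∀ c → ¬ ((∀ d → d ≢ c → Q c d) ⊎ (∀ d → d ≢ c → ¬ Q c d))
    no-uniform-vertex c uniform with two-others (proj₁ Q-prime) c
    ... | a , b , a≢c , b≢c , a≢b
      with proj₂ Q-prime (_≢ c) ((a , a≢c) , λ x ¬x≢c →
             subst (λ x → (∀ d → d ≢ c → Q x d) ⊎ (∀ d → d ≢ c → ¬ Q x d))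
               (sym (decidable-stable (x ≟ c) ¬x≢c)) uniform)
    ... | inj₁ everything = everything c refl
    ... | inj₂ (_ , single) = a≢b (trans (single a a≢c) (sym (single b b≢c)))

  prime-no-universal-vertex : ∀ c → ¬ (∀ d → d ≢ c → Q c d)
  prime-no-universal-vertex c universal = no-uniform-vertex c (inj₁ universal)

  prime-no-isolated-vertex : ∀ c → ¬ (∀ d → ¬ Q c d)
  prime-no-isolated-vertex c isolated = no-uniform-vertex c (inj₂ λ d _ → isolated d)

  prime-not-complete : ¬ Complete Q
  prime-not-complete Q-complete = prime-no-universal-vertex c λ d d≢c → Q-complete c d (≢-sym d≢c)
    where c = proj₁ (distinct-pair (proj₁ Q-prime))

  prime-not-edgeless : ¬ Edgeless Q
  prime-not-edgeless Q-edgeless = prime-no-isolated-vertex c (Q-edgeless c)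
    where c = proj₁ (distinct-pair (proj₁ Q-prime))

module _ {n} (H : Graph n) where

  open Graph H using (E) renaming (sym to E-sym)

  PartQuotient : ∀ {k} → (Fin k → Fin n → Set) → Rel (Fin k) 0ℓ
  PartQuotient X i j = i ≢ j × ∃[ x ] ∃[ y ] (X i x × X j y × E x y)

  disjoint-modules-fully-adjacent : ∀ {M N} → IsModule E M → IsModule E N →
    (∀ z → M z → ¬ N z) → ∀ {x y w m} → M x → N y → E x y → M w → N m → E w m
  disjoint-modules-fully-adjacent M-module N-module disjoint {x} {y} {w} Mx Ny Exy Mw Nm
    with proj₂ M-module y (λ My → disjoint y My Ny)
  ... | inj₂ y-nonadjacent = ⊥-elim (y-nonadjacent x Mx (E-sym Exy))
  ... | inj₁ y-adjacent with proj₂ N-module w (λ Nw → disjoint w Mw Nw)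
  ...   | inj₁ w-adjacent = w-adjacent _ Nm
  ...   | inj₂ w-nonadjacent = ⊥-elim (w-nonadjacent y Ny (E-sym (y-adjacent w Mw)))

  part-quotient⇒edge : ∀ {k} {X : Fin k → Fin n → Set} → PairwiseDisjoint X →
    (∀ d → IsModule E (X d)) → ∀ {i j w m} → PartQuotient X i j → X i w → X j m → E w m
  part-quotient⇒edge disjoint modules {i} {j} (i≢j , x , y , Xx , Xy , Exy) =
    disjoint-modules-fully-adjacent (modules i) (modules j)
      (λ z Xiz Xjz → i≢j (disjoint i j z Xiz Xjz)) Xx Xy Exy

  module PrimePartition {k} (X : Fin k → Fin n → Set)
    (disjoint : PairwiseDisjoint X) (modules : ∀ d → IsModule E (X d))
    (nonempty : ∀ d → ∃ (X d)) (quotient-prime : PrimeGraph (PartQuotient X)) where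

    part-edge : ∀ {i j w m} → PartQuotient X i j → X i w → X j m → E w m
    part-edge = part-quotient⇒edge disjoint modules

    module-meeting-two-parts : ∀ {M} → IsModule E M → (∀ z → Dec (M z)) →
      ∀ {i j a b} → i ≢ j → X i a → M a → X j b → M b → ∀ d z → X d z → M z
    module-meeting-two-parts {M} M-module M? {i} {j} {a} {b} i≢j Xa Ma Xb Mb d z Xz =
      decidable-stable (M? z) λ z∉M → [ universal , isolated ]′ (proj₂ M-module z z∉M)
      where
      Meets : Fin k → Set
      Meets e = ∃ λ w → X e w × M w

      meets-module : IsModule (PartQuotient X) Meets
      meets-module = (i , a , Xa , Ma) , outside
        where
        outside : ∀ e → ¬ Meets e →
          (∀ f → Meets f → PartQuotient X e f) ⊎ (∀ f → Meets f → ¬ PartQuotient X e f)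
        outside e e-misses with nonempty e
        ... | w , Xw with proj₂ M-module w (λ Mw → e-misses (w , Xw , Mw))
        ... | inj₁ adjacent = inj₁ λ { f (m , Xm , Mm) →
                (λ { refl → e-misses (m , Xm , Mm) }) , w , m , Xw , Xm , adjacent m Mm }
        ... | inj₂ nonadjacent =
                inj₂ λ { f (m , Xm , Mm) Qef → nonadjacent m Mm (part-edge Qef Xw Xm) }

      meets-all : ∀ e → Meets e
      meets-all with proj₂ quotient-prime Meets meets-module
      ... | inj₁ all = all
      ... | inj₂ (_ , single) =
        ⊥-elim (i≢j (trans (single i (a , Xa , Ma)) (sym (single j (b , Xb , Mb)))))

      universal : ¬ (∀ y → M y → E z y)
      universal adjacent = prime-no-universal-vertex quotient-prime d λ e e≢d →
        let (m , Xm , Mm) = meets-all e in ≢-sym e≢d , z , m , Xz , Xm , adjacent m Mm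

      isolated : ¬ (∀ y → M y → ¬ E z y)
      isolated nonadjacent = prime-no-isolated-vertex quotient-prime d λ e Qde →
        let (m , Xm , Mm) = meets-all e in nonadjacent m Mm (part-edge Qde Xz Xm)

    module-meets-one-part : ∀ {M} → IsModule E M → (∀ z → Dec (M z)) →
      ¬ (∀ d z → X d z → M z) → ∀ {i j x y} → X i x → M x → X j y → M y → i ≡ j
    module-meets-one-part M-module M? misses {i} {j} Xx Mx Xy My =
      decidable-stable (i ≟ j) λ i≢j → misses (module-meeting-two-parts M-module M? i≢j Xx Mx Xy My)

    module-meets-partial-transversal-once : ∀ {M} → IsModule E M → (∀ z → Dec (M z)) →
      ¬ (∀ d z → X d z → M z) → ∀ {S : Fin n → Set} → (∀ x → S x → ∃ λ d → X d x) →
      (∀ d x y → S x → S y → X d x → X d y → x ≡ y) →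
      ∀ {x y} → S x → S y → M x → M y → x ≡ y
    module-meets-partial-transversal-once M-module M? misses S⊆parts transversal {x} {y}
      Sx Sy Mx My =
      let (i , Xx) = S⊆parts x Sx
          (j , Xy) = S⊆parts y Sy
      in transversal i x y Sx Sy Xx
           (subst (λ d → X d y) (sym (module-meets-one-part M-module M? misses Xx Mx Xy My)) Xy)

    parts-not-singleton : ∀ w → ¬ (∀ d x → X d x → w ≡ x)
    parts-not-singleton w singleton with distinct-pair (proj₁ quotient-prime)
    ... | i , j , i≢j with nonempty i | nonempty j
    ... | x , Xx | y , Xy with singleton i x Xx | singleton j y Xy
    ... | refl | refl = i≢j (disjoint i j w Xx Xy)

    module MinimalCover (s : Tree Label n)
      (s-disjoint : PairwiseDisjoint (children s)) (s-modules : ∀ a → IsModule E (children s a))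
      (covers : ∀ d x → X d x → Lf s x) (minimal : ∀ a → ¬ (∀ d x → X d x → children s a x))
      (s-node : IsNode s) where

      distinct-children : ∀ {i j x y} → i ≢ j → X i x → X j y →
        ∃ λ a → ∃ λ b → a ≢ b × children s a x × children s b y
      distinct-children i≢j Xx Xy
        with Lf-child s s-node (covers _ _ Xx) | Lf-child s s-node (covers _ _ Xy)
      ... | a , x∈a | b , y∈b = a , b , a≢b , x∈a , y∈b
        where
        a≢b : a ≢ b
        a≢b refl =
          i≢j (module-meets-one-part (s-modules a) (Lf? (child s a)) (minimal a) Xx x∈a Xy y∈b)

      complete-restricts : Complete (Quotient H s) → Complete (PartQuotient X)
      complete-restricts s-complete i j i≢j =
        let (x , Xx) = nonempty i
            (y , Xy) = nonempty j
            (a , b , a≢b , x∈a , y∈b) = distinct-children i≢j Xx Xy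
        in i≢j , x , y , Xx , Xy ,
           part-quotient⇒edge s-disjoint s-modules (s-complete a b a≢b) x∈a y∈b

      edgeless-restricts : Edgeless (Quotient H s) → Edgeless (PartQuotient X)
      edgeless-restricts s-edgeless i j (i≢j , x , y , Xx , Xy , Exy) =
        let (a , b , a≢b , x∈a , y∈b) = distinct-children i≢j Xx Xy
        in s-edgeless a b (a≢b , x , y , x∈a , y∈b , Exy)

    minimal-cover-is-prime-labelled : (s : Tree Label n) →
      PairwiseDisjoint (children s) → (∀ a → IsModule E (children s a)) →
      (∀ d x → X d x → Lf s x) → (∀ a → ¬ (∀ d x → X d x → children s a x)) →
      (HasLabel s complete → Complete (Quotient H s)) →
      (HasLabel s empty → Edgeless (Quotient H s)) → HasLabel s prime
    minimal-cover-is-prime-labelled (leaf w) _ _ covers _ _ _ =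
      ⊥-elim (parts-not-singleton w covers)
    minimal-cover-is-prime-labelled (node _ prime _) _ _ _ _ _ _ = labelled
    minimal-cover-is-prime-labelled s@(node _ complete _) s-disjoint s-modules covers minimal
      s-complete _ =
      ⊥-elim (prime-not-complete quotient-prime (complete-restricts (s-complete labelled)))
      where open MinimalCover s s-disjoint s-modules covers minimal tt
    minimal-cover-is-prime-labelled s@(node _ empty _) s-disjoint s-modules covers minimal
      _ s-edgeless =
      ⊥-elim (prime-not-edgeless quotient-prime (edgeless-restricts (s-edgeless labelled)))
      where open MinimalCover s s-disjoint s-modules covers minimal tt

mainTheorem10 : ∀ {n} (H : Graph n) (B : Tree ⊤ n) (T : Tree Label n)
    (D : (p : Pos T) → HasLabel (subtree p) prime → Rel (Fin (arity (subtree p))) 0ℓ) →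
    IsComparabilityGraph H → IsCanonicalMD H B → IsRestrictedMD H T D →
    (μ : Pos B) → IsPrimeNode H μ →
    (μ' : Pos T) → IsLCA μ' (L μ) →
    HasLabel (subtree μ') prime
    × (∀ (S : Subset n) → IsMuSet μ S → IsMuSet μ' S)
    × (∀ u v → Graph.E H u v → IsLCA μ (Pair u v) → IsLCA μ' (Pair u v))
mainTheorem10 H _ _ _ _ (mdB@(treeB , _) , _) (mdT@(treeT , modulesT) , completeT , emptyT , _)
  μ (μ-node , μ-prime) μ' μ'-lca@(L-μ⊆μ' , _) = μ'-prime , μ-sets , edge-lca
  where
  s = subtree μ
  open PrimePartition H (children s)
    (children-disjoint s (LeavesUnique-subtree (proj₂ (proj₂ treeB)) μ))
    (children-modules {H = H} mdB μ) (children-nonempty (proj₁ treeB) μ) μ-prime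

  parts⊆⇒L-μ⊆ : ∀ {M : Fin _ → Set} → (∀ d x → children s d x → M x) → ∀ x → L μ x → M x
  parts⊆⇒L-μ⊆ parts⊆ x x∈μ = let (d , x∈d) = Lf-child s μ-node x∈μ in parts⊆ d x x∈d

  μ'-minimal : ∀ a → ¬ (∀ d x → children s d x → children (subtree μ') a x)
  μ'-minimal a = lca-child-misses μ'-lca a ∘′ parts⊆⇒L-μ⊆

  μ'-prime : HasLabel (subtree μ') prime
  μ'-prime = minimal-cover-is-prime-labelled (subtree μ')
    (children-disjoint _ (LeavesUnique-subtree (proj₂ (proj₂ treeT)) μ'))
    (children-modules {H = H} mdT μ') (λ d x x∈d → L-μ⊆μ' x (child-Lf s x∈d)) μ'-minimal
    (completeT μ') (emptyT μ')

  μ-sets : ∀ S → IsMuSet μ S → IsMuSet μ' S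
  μ-sets S (S⊆μ , S-μ-set) = (λ x x∈S → L-μ⊆μ' x (S⊆μ x x∈S)) , λ a x y x∈S y∈S →
    module-meets-partial-transversal-once (children-modules {H = H} mdT μ' a)
      (Lf? (child (subtree μ') a)) (μ'-minimal a) (λ x x∈S → Lf-child s μ-node (S⊆μ x x∈S))
      S-μ-set x∈S y∈S

  edge-lca : ∀ u v → Graph.E H u v → IsLCA μ (Pair u v) → IsLCA μ' (Pair u v)
  edge-lca u v _ uv-lca@(uv⊆μ , _) = (λ x x∈uv → L-μ⊆μ' x (uv⊆μ x x∈uv)) , above-μ'
    where
    above-μ' : ∀ q → (∀ x → Pair u v x → L q x) → q ≼ μ'
    above-μ' q uv⊆q =
      let (i , u∈i) = Lf-child s μ-node (uv⊆μ u (inj₁ refl))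
          (j , v∈j) = Lf-child s μ-node (uv⊆μ v (inj₂ refl))
      in proj₂ μ'-lca q (parts⊆⇒L-μ⊆ (module-meeting-two-parts (modulesT q) (Lf? (subtree q))
           (lca-pair-children-distinct uv-lca u∈i v∈j)
           u∈i (uv⊆q u (inj₁ refl)) v∈j (uv⊆q v (inj₂ refl))))
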